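{- Let $G$ be a finite connected even graph, let $\mathcal{C}$ be a cycle decomposition of $G$, and let $CI(G)$ be the cycle intersection graph of $G$ with respect to $\mathcal{C}$. If $CI(G)$ is a path with $|E(CI(G))|=n$, then $\nabla(G)=\left\lceil\frac{n+1}{2}\right\rceil$.
   Context: An even graph is a graph in which every vertex has even degree (multiple edges are allowed). A cycle decomposition of $G$ is a collection of cycles of $G$ whose edge sets partition $E(G)$. The cycle intersection graph $CI(G)$ with respect to $\mathcal{C}$ is the (multi)graph with vertex set $\mathcal{C}$ having, for each pair of distinct cycles $C,C'\in\mathcal{C}$ and each vertex $v\in V(C)\cap V(C')$, one edge joining $C$ and $C'$. A decycling set of $G$ is a set $S\subseteq V(G)$ with $G\setminus S$ acyclic; $\nabla(G)$ is the minimum size of a decycling set. -}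

module Defs where

open import Data.Nat using (ℕ; zero; suc; _+_; _*_; _≤_; _<_; NonZero)
open import Data.Nat.DivMod using (_mod_)
open import Data.Fin using (Fin; toℕ; inject₁) renaming (suc to fsuc; zero to fzero)
import Data.Fin as Fin
open import Data.Fin.Subset using (Subset; _∈_; ∣_∣)
open import Data.List using (List; map; allFin)
open import Data.Nat.ListAction using (sum)
open import Data.Product using (Σ; ∃; _×_; _,_; proj₁; proj₂)
open import Data.Sum using (_⊎_)
open import Relation.Nullary using (¬_; yes; no)
open import Relation.Binary.PropositionalEquality using (_≡_; _≢_)
open import Function.Definitions using (Injective)
open import Function.Bundles using (_↔_; Inverse)

record Graph : Set where
  field
    V        : ℕ
    E        : ℕ
    ends     : Fin E → Fin V × Fin V
    loopless : ∀ e → proj₁ (ends e) ≢ proj₂ (ends e)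
open Graph public

Joins : (G : Graph) → Fin (E G) → Fin (V G) → Fin (V G) → Set
Joins G e u v = (ends G e ≡ (u , v)) ⊎ (ends G e ≡ (v , u))

incidence : (G : Graph) → Fin (V G) → Fin (E G) → ℕ
incidence G v e with proj₁ (ends G e) Fin.≟ v | proj₂ (ends G e) Fin.≟ v
... | yes _ | _     = 1
... | no _  | yes _ = 1
... | no _  | no _  = 0

degree : (G : Graph) → Fin (V G) → ℕ
degree G v = sum (map (incidence G v) (allFin (E G)))

Even : Graph → Set
Even G = ∀ v → Σ ℕ λ k → degree G v ≡ 2 * k

data Reach (G : Graph) : Fin (V G) → Fin (V G) → Set where
  here : ∀ {u} → Reach G u u
  step : ∀ {u v w} (e : Fin (E G)) → Joins G e u v → Reach G v w → Reach G u w

Connected : Graph → Set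
Connected G = ∀ u v → Reach G u v

next : ∀ {k} → Fin (suc k) → Fin (suc k)
next {k} i = suc (toℕ i) mod (suc k)

record Cycle (G : Graph) : Set where
  field
    k      : ℕ                       -- length is suc (suc k) ≥ 2
    vert   : Fin (suc (suc k)) → Fin (V G)
    edge   : Fin (suc (suc k)) → Fin (E G)
    vert-injective : Injective _≡_ _≡_ vert
    edge-injective : Injective _≡_ _≡_ edge
    joins  : ∀ i → Joins G (edge i) (vert i) (vert (next i))
open Cycle public

_∈V_ : {G : Graph} → Fin (V G) → Cycle G → Set
v ∈V C = ∃ λ i → vert C i ≡ v

_∈E_ : {G : Graph} → Fin (E G) → Cycle G → Set
e ∈E C = ∃ λ i → edge C i ≡ e

IsCycleDecomposition : (G : Graph) {m : ℕ} → (Fin m → Cycle G) → Set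
IsCycleDecomposition G {m} 𝒞 =
  (∀ e → ∃ λ j → e ∈E 𝒞 j) ×
  (∀ e j j' → e ∈E 𝒞 j → e ∈E 𝒞 j' → j ≡ j')

record Multigraph : Set₁ where
  field
    MV    : ℕ
    MEdge : Set
    mends : MEdge → Fin MV × Fin MV
open Multigraph public

-- H is isomorphic to the path P_{n+1} (n+1 vertices, n edges):
-- vertices enumerated φ 0 … φ n, edges ψ 0 … ψ (n-1), ψ k joins φ k and φ (k+1).
IsPath : Multigraph → ℕ → Set
IsPath H n =
  Σ (Fin (suc n) ↔ Fin (MV H)) λ φ →
  Σ (Fin n ↔ MEdge H) λ ψ →
    ∀ i → (mends H (Inverse.to ψ i) ≡ (Inverse.to φ (inject₁ i) , Inverse.to φ (fsuc i)))
        ⊎ (mends H (Inverse.to ψ i) ≡ (Inverse.to φ (fsuc i) , Inverse.to φ (inject₁ i)))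

-- Cycle intersection graph: vertices = the cycles (indices j : Fin m);
-- for each pair j < j' and each common vertex v, one edge joining j and j'.
-- A common vertex v is recorded by its positions i in 𝒞 j and i' in 𝒞 j'
-- (vertices of a cycle are distinct, so this is the same as recording v).
CIEdge : (G : Graph) {m : ℕ} → (Fin m → Cycle G) → Set
CIEdge G {m} 𝒞 =
  Σ (Fin m) λ j → Σ (Fin m) λ j' → (toℕ j < toℕ j') ×
  Σ (Fin (suc (suc (k (𝒞 j))))) λ i → Σ (Fin (suc (suc (k (𝒞 j'))))) λ i' →
    vert (𝒞 j) i ≡ vert (𝒞 j') i'

CI : (G : Graph) {m : ℕ} → (Fin m → Cycle G) → Multigraph
CI G {m} 𝒞 = record
  { MV    = m
  ; MEdge = CIEdge G 𝒞
  ; mends = λ x → proj₁ x , proj₁ (proj₂ x)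
  }

-- S is decycling iff G \ S is acyclic, i.e. every cycle of G meets S.
IsDecycling : (G : Graph) → Subset (V G) → Set
IsDecycling G S = ∀ (C : Cycle G) → ∃ λ i → vert C i ∈ S

DecyclingNumberIs : Graph → ℕ → Set
DecyclingNumberIs G d =
  (Σ (Subset (V G)) λ S → IsDecycling G S × ∣ S ∣ ≡ d) ×
  (∀ S → IsDecycling G S → d ≤ ∣ S ∣)

module Submission where

-- Write D₀, …, Dₙ for the cycles of the decomposition in the order of the path CI(G).
-- Distinct members Dᵢ, Dⱼ share a vertex only if |i − j| = 1, and then exactly one.
-- Every cycle C of G uses edges of a single member: walking along C, the member
-- containing the current edge can only move to a neighbouring member, so if C left
-- the highest member it reaches it would have to leave it and come back through the
-- unique vertex that member shares with the one below, which C visits only once.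
-- A cycle whose edges all lie in Dᵢ passes through every vertex of Dᵢ, so a vertex set
-- is decycling exactly when it meets every member.  The members D₀, D₂, D₄, … are
-- pairwise disjoint, which gives the lower bound ⌈(n+1)/2⌉, and choosing, for every
-- even i, a vertex shared by Dᵢ and Dᵢ₊₁ meets all members.

open import Defs
open import Data.Nat using (ℕ; zero; suc; _+_; _*_; _%_; _≤_; _<_; z≤n; s≤s; s≤s⁻¹; ⌊_/2⌋; ⌈_/2⌉)
open import Data.Nat.Properties
  using (≤-trans; ≤-reflexive; ≤-antisym; n≤1+n; +-suc; *-suc; *-monoʳ-≤; *-cancelˡ-≡;
         even≢odd; ⌊n/2⌋-mono; <-irrefl; <-asym; 1+n≢n; suc-injective)
open import Data.Nat.DivMod using (m<n⇒m%n≡m; n%n≡0)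
open import Data.Fin using (Fin; toℕ; inject₁; fromℕ; fromℕ<) renaming (zero to fzero; suc to fsuc)
open import Data.Fin.Properties
  using (toℕ-injective; toℕ-inject₁; toℕ-fromℕ; toℕ-fromℕ<; toℕ<n; ≤fromℕ; 0≢1+n;
         _≟_; <-cmp; ¬∀⟶∃¬)
  renaming (suc-injective to fsuc-injective)
open import Data.Fin.Induction using (<-weakInduction; <-weakInduction-startingFrom)
open import Data.Fin.Relation.Unary.Top using (view; ‵fromℕ; ‵inject₁)
open import Data.Fin.Subset using (Subset; _∈_; ∣_∣; _∪_; ⁅_⁆; _-_; inside; outside) renaming (⊥ to ∅)
open import Data.Fin.Subset.Properties
  using (x∈p∪q⁺; x∈⁅x⁆; ∣⁅x⁆∣≡1; ∣⊥∣≡0; x∈p∧x≢y⇒x∈p-y; x∈p⇒∣p-x∣<∣p∣)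
open import Data.Vec using ([]; _∷_)
open import Data.List using (allFin)
open import Data.List.Extrema.Nat using (argmax; f[xs]≤f[argmax])
open import Data.List.Relation.Unary.All using (lookup)
open import Data.List.Membership.Propositional.Properties using (∈-allFin)
open import Data.Product using (Σ; ∃; _×_; _,_; proj₁; proj₂)
open import Data.Sum using (_⊎_; inj₁; inj₂) renaming (map to ⊎-map; swap to ⊎-swap)
open import Data.Empty using (⊥; ⊥-elim)
open import Function using (_∘_; _↔_; Inverse)
open import Function.Definitions using (Injective)
open import Relation.Nullary using (¬_; yes; no; ¬?; _→-dec_)
open import Relation.Nullary.Decidable using (decidable-stable)
open import Relation.Unary using (Decidable)
open import Relation.Binary using (tri<; tri≈; tri>)
open import Relation.Binary.PropositionalEquality
  using (_≡_; _≢_; refl; sym; trans; cong; cong₂; subst; subst₂; ≢-sym; module ≡-Reasoning)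

n≡2*⌊n/2⌋⊎n≡1+2*⌊n/2⌋ : ∀ n → n ≡ 2 * ⌊ n /2⌋ ⊎ n ≡ suc (2 * ⌊ n /2⌋)
n≡2*⌊n/2⌋⊎n≡1+2*⌊n/2⌋ zero          = inj₁ refl
n≡2*⌊n/2⌋⊎n≡1+2*⌊n/2⌋ (suc zero)    = inj₂ refl
n≡2*⌊n/2⌋⊎n≡1+2*⌊n/2⌋ (suc (suc n)) =
  ⊎-map (λ e → trans (cong (suc ∘ suc) e) (sym (*-suc 2 ⌊ n /2⌋)))
        (λ e → trans (cong (suc ∘ suc) e) (cong suc (sym (*-suc 2 ⌊ n /2⌋))))
        (n≡2*⌊n/2⌋⊎n≡1+2*⌊n/2⌋ n)

2*⌊n/2⌋≤n : ∀ n → 2 * ⌊ n /2⌋ ≤ n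
2*⌊n/2⌋≤n n with n≡2*⌊n/2⌋⊎n≡1+2*⌊n/2⌋ n
... | inj₁ e = ≤-reflexive (sym e)
... | inj₂ e = ≤-trans (n≤1+n _) (≤-reflexive (sym e))

Adjacent : ∀ {n} → Fin n → Fin n → Set
Adjacent i i' = toℕ i' ≡ suc (toℕ i) ⊎ toℕ i ≡ suc (toℕ i')

adjacent-below : ∀ {n} {i i' : Fin n} → Adjacent i i' → toℕ i' ≤ toℕ i → toℕ i ≡ suc (toℕ i')
adjacent-below (inj₁ e) i'≤i = ⊥-elim (<-irrefl refl (≤-trans (≤-reflexive (sym e)) i'≤i))
adjacent-below (inj₂ e) _    = e

PathEdge : ∀ {n} → Fin n → Fin (suc n) → Fin (suc n) → Set
PathEdge q i i' = (i , i') ≡ (inject₁ q , fsuc q) ⊎ (i , i') ≡ (fsuc q , inject₁ q)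

PathEdge-sym : ∀ {n} {q : Fin n} {i i'} → PathEdge q i i' → PathEdge q i' i
PathEdge-sym (inj₁ refl) = inj₂ refl
PathEdge-sym (inj₂ refl) = inj₁ refl

PathEdge⇒Adjacent : ∀ {n} {q : Fin n} {i i'} → PathEdge q i i' → Adjacent i i'
PathEdge⇒Adjacent {q = q} (inj₁ refl) = inj₁ (cong suc (sym (toℕ-inject₁ q)))
PathEdge⇒Adjacent {q = q} (inj₂ refl) = inj₂ (cong suc (sym (toℕ-inject₁ q)))

inject₁≡suc⇒suc≢inject₁ : ∀ {n} {q q' : Fin n} → inject₁ q ≡ fsuc q' → fsuc q ≢ inject₁ q'
inject₁≡suc⇒suc≢inject₁ {q = q} {q'} a b =
  <-asym (≤-reflexive (trans (cong toℕ (sym a)) (toℕ-inject₁ q)))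
         (≤-reflexive (trans (cong toℕ b) (toℕ-inject₁ q')))

PathEdge-unique : ∀ {n} {q q' : Fin n} {i i'} → PathEdge q i i' → PathEdge q' i i' → q ≡ q'
PathEdge-unique (inj₁ refl) (inj₁ e) = fsuc-injective (cong proj₂ e)
PathEdge-unique (inj₂ refl) (inj₂ e) = fsuc-injective (cong proj₁ e)
PathEdge-unique (inj₁ refl) (inj₂ e) = ⊥-elim (inject₁≡suc⇒suc≢inject₁ (cong proj₁ e) (cong proj₂ e))
PathEdge-unique (inj₂ refl) (inj₁ e) = ⊥-elim (inject₁≡suc⇒suc≢inject₁ (cong proj₂ e) (cong proj₁ e))

evenAt : ∀ {n} → Fin ⌈ suc n /2⌉ → Fin (suc n)
evenAt {n} r = fromℕ< (s≤s (≤-trans (*-monoʳ-≤ 2 (s≤s⁻¹ (toℕ<n r))) (2*⌊n/2⌋≤n n)))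

toℕ-evenAt : ∀ {n} (r : Fin ⌈ suc n /2⌉) → toℕ (evenAt r) ≡ 2 * toℕ r
toℕ-evenAt r = toℕ-fromℕ< _

evenAt-injective : ∀ {n} → Injective _≡_ _≡_ (evenAt {n})
evenAt-injective {x = r} {r'} e =
  toℕ-injective (*-cancelˡ-≡ (toℕ r) (toℕ r') 2
    (trans (sym (toℕ-evenAt r)) (trans (cong toℕ e) (toℕ-evenAt r'))))

evenAt-nonadjacent : ∀ {n} (r r' : Fin ⌈ suc n /2⌉) → ¬ Adjacent (evenAt r) (evenAt r')
evenAt-nonadjacent r r' (inj₁ e) =
  even≢odd (toℕ r') (toℕ r) (trans (sym (toℕ-evenAt r')) (trans e (cong suc (toℕ-evenAt r))))
evenAt-nonadjacent r r' (inj₂ e) =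
  even≢odd (toℕ r) (toℕ r') (trans (sym (toℕ-evenAt r)) (trans e (cong suc (toℕ-evenAt r'))))

evenAt-covers : ∀ {n} (i : Fin (suc n)) →
                ∃ λ r → toℕ i ≡ toℕ (evenAt r) ⊎ toℕ i ≡ suc (toℕ (evenAt r))
evenAt-covers {n} i = r , subst (λ x → toℕ i ≡ x ⊎ toℕ i ≡ suc x) (sym toℕ-evenAt-r)
                                (n≡2*⌊n/2⌋⊎n≡1+2*⌊n/2⌋ (toℕ i))
  where
  ⌊i/2⌋<⌈1+n/2⌉ : ⌊ toℕ i /2⌋ < ⌈ suc n /2⌉
  ⌊i/2⌋<⌈1+n/2⌉ = s≤s (⌊n/2⌋-mono (s≤s⁻¹ (toℕ<n i)))
  r : Fin ⌈ suc n /2⌉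
  r = fromℕ< ⌊i/2⌋<⌈1+n/2⌉
  toℕ-evenAt-r : toℕ (evenAt r) ≡ 2 * ⌊ toℕ i /2⌋
  toℕ-evenAt-r = trans (toℕ-evenAt r) (cong (2 *_) (toℕ-fromℕ< ⌊i/2⌋<⌈1+n/2⌉))

∣p∪q∣≤∣p∣+∣q∣ : ∀ {n} (p q : Subset n) → ∣ p ∪ q ∣ ≤ ∣ p ∣ + ∣ q ∣
∣p∪q∣≤∣p∣+∣q∣ []            []            = z≤n
∣p∪q∣≤∣p∣+∣q∣ (outside ∷ p) (outside ∷ q) = ∣p∪q∣≤∣p∣+∣q∣ p q
∣p∪q∣≤∣p∣+∣q∣ (inside ∷ p)  (outside ∷ q) = s≤s (∣p∪q∣≤∣p∣+∣q∣ p q)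
∣p∪q∣≤∣p∣+∣q∣ (outside ∷ p) (inside ∷ q)  =
  ≤-trans (s≤s (∣p∪q∣≤∣p∣+∣q∣ p q)) (≤-reflexive (sym (+-suc ∣ p ∣ ∣ q ∣)))
∣p∪q∣≤∣p∣+∣q∣ (inside ∷ p)  (inside ∷ q)  =
  s≤s (≤-trans (∣p∪q∣≤∣p∣+∣q∣ p q) (≤-trans (n≤1+n _) (≤-reflexive (sym (+-suc ∣ p ∣ ∣ q ∣)))))

image : ∀ {c n} → (Fin c → Fin n) → Subset n
image {zero}  f = ∅
image {suc c} f = ⁅ f fzero ⁆ ∪ image (f ∘ fsuc)

∈image : ∀ {c n} (f : Fin c → Fin n) r → f r ∈ image f
∈image f fzero    = x∈p∪q⁺ (inj₁ (x∈⁅x⁆ (f fzero)))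
∈image f (fsuc r) = x∈p∪q⁺ (inj₂ (∈image (f ∘ fsuc) r))

∣image∣≤ : ∀ {c n} (f : Fin c → Fin n) → ∣ image f ∣ ≤ c
∣image∣≤ {zero}  {n} f = ≤-reflexive (∣⊥∣≡0 n)
∣image∣≤ {suc c}     f =
  ≤-trans (∣p∪q∣≤∣p∣+∣q∣ ⁅ f fzero ⁆ (image (f ∘ fsuc)))
          (subst (λ k → k + ∣ image (f ∘ fsuc) ∣ ≤ suc c) (sym (∣⁅x⁆∣≡1 (f fzero)))
                 (s≤s (∣image∣≤ (f ∘ fsuc))))

injective⇒≤∣∣ : ∀ {c n} {S : Subset n} (f : Fin c → Fin n) →
                Injective _≡_ _≡_ f → (∀ r → f r ∈ S) → c ≤ ∣ S ∣
injective⇒≤∣∣ {zero}          f f-inj f∈S = z≤n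
injective⇒≤∣∣ {suc c} {S = S} f f-inj f∈S =
  ≤-trans (s≤s (injective⇒≤∣∣ (f ∘ fsuc) (fsuc-injective ∘ f-inj) f∘fsuc∈S-f₀))
          (x∈p⇒∣p-x∣<∣p∣ (f∈S fzero))
  where
  f∘fsuc∈S-f₀ : ∀ r → f (fsuc r) ∈ S - f fzero
  f∘fsuc∈S-f₀ r = x∈p∧x≢y⇒x∈p-y (f∈S (fsuc r)) (0≢1+n ∘ sym ∘ f-inj)

next-inject₁ : ∀ {k} (i : Fin k) → next (inject₁ i) ≡ fsuc i
next-inject₁ {k} i = toℕ-injective (begin
  toℕ (next (inject₁ i))        ≡⟨ toℕ-fromℕ< _ ⟩
  suc (toℕ (inject₁ i)) % suc k ≡⟨ cong (λ x → suc x % suc k) (toℕ-inject₁ i) ⟩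
  suc (toℕ i) % suc k           ≡⟨ m<n⇒m%n≡m (s≤s (toℕ<n i)) ⟩
  suc (toℕ i)                   ∎)
  where open ≡-Reasoning

next-fromℕ : ∀ {k} → next (fromℕ k) ≡ fzero
next-fromℕ {k} = toℕ-injective (begin
  toℕ (next (fromℕ k))          ≡⟨ toℕ-fromℕ< _ ⟩
  suc (toℕ (fromℕ k)) % suc k   ≡⟨ cong (λ x → suc x % suc k) (toℕ-fromℕ k) ⟩
  suc k % suc k                 ≡⟨ n%n≡0 (suc k) ⟩
  0                             ∎)
  where open ≡-Reasoning

next-injective : ∀ {k} → Injective _≡_ _≡_ (next {k})
next-injective {x = i} {j} e with view i | view j
... | ‵fromℕ      | ‵fromℕ      = refl
... | ‵fromℕ      | ‵inject₁ j' = ⊥-elim (0≢1+n (trans (sym next-fromℕ) (trans e (next-inject₁ j'))))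
... | ‵inject₁ i' | ‵fromℕ      = ⊥-elim (0≢1+n (trans (sym next-fromℕ) (trans (sym e) (next-inject₁ i'))))
... | ‵inject₁ i' | ‵inject₁ j' =
  cong inject₁ (fsuc-injective (trans (sym (next-inject₁ i')) (trans e (next-inject₁ j'))))

next-surjective : ∀ {k} (u : Fin (suc k)) → ∃ λ t → next t ≡ u
next-surjective fzero    = fromℕ _ , next-fromℕ
next-surjective (fsuc u) = inject₁ u , next-inject₁ u

next-irreflexive : ∀ {k} (i : Fin (suc (suc k))) → next i ≢ i
next-irreflexive i e with view i
... | ‵fromℕ     = 0≢1+n (trans (sym next-fromℕ) e)
... | ‵inject₁ j = 1+n≢n (trans (cong toℕ (trans (sym (next-inject₁ j)) e)) (toℕ-inject₁ j))

cyclic-induction : ∀ {k} (P : Fin (suc k) → Set) → (∀ t → P t → P (next t)) →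
                   ∀ {x} → P x → ∀ y → P y
cyclic-induction P closed {x} px = <-weakInduction P P₀ step⁺
  where
  step⁺ : ∀ j → P (inject₁ j) → P (fsuc j)
  step⁺ j = subst P (next-inject₁ j) ∘ closed (inject₁ j)
  P₀ : P fzero
  P₀ = subst P next-fromℕ (closed _ (<-weakInduction-startingFrom P px step⁺ (≤fromℕ x)))

cyclic-exit : ∀ {k} (P : Fin (suc k) → Set) → Decidable P →
              ∀ {x y} → P x → ¬ P y → ∃ λ t → P t × ¬ P (next t)
cyclic-exit P P? {y = y} px ¬py
  with ¬∀⟶∃¬ _ (λ t → P t → P (next t)) (λ t → P? t →-dec P? (next t))
             (λ closed → ¬py (cyclic-induction P closed px y))
... | t , ¬closed = t , decidable-stable (P? t) (λ ¬pt → ¬closed (⊥-elim ∘ ¬pt))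
                      , (λ pnt → ¬closed (λ _ → pnt))

module _ {G : Graph} where

  Joins-ends : ∀ {e a b c d} → Joins G e a b → Joins G e c d → (c ≡ a × d ≡ b) ⊎ (c ≡ b × d ≡ a)
  Joins-ends (inj₁ p) (inj₁ q) with trans (sym q) p
  ... | refl = inj₁ (refl , refl)
  Joins-ends (inj₁ p) (inj₂ q) with trans (sym q) p
  ... | refl = inj₂ (refl , refl)
  Joins-ends (inj₂ p) (inj₁ q) with trans (sym q) p
  ... | refl = inj₂ (refl , refl)
  Joins-ends (inj₂ p) (inj₂ q) with trans (sym q) p
  ... | refl = inj₁ (refl , refl)

  ∈E⇒∈V : (D : Cycle G) → ∀ {e a b} → e ∈E D → Joins G e a b → a ∈V D × b ∈V D
  ∈E⇒∈V D (q , refl) j with Joins-ends (joins D q) j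
  ... | inj₁ (refl , refl) = (q , refl) , (next q , refl)
  ... | inj₂ (refl , refl) = (next q , refl) , (q , refl)

  edge-at-vertex : (D : Cycle G) → ∀ {e p w} → (eD : e ∈E D) → Joins G e (vert D p) w →
                   vert D (next p) ≡ w ⊎ next (proj₁ eD) ≡ p
  edge-at-vertex D (q , refl) j with Joins-ends (joins D q) j
  ... | inj₁ (vp≡vq , w≡vnq) = inj₁ (trans (cong (vert D ∘ next) (vert-injective D vp≡vq)) (sym w≡vnq))
  ... | inj₂ (vp≡vnq , _)    = inj₂ (sym (vert-injective D vp≡vnq))

  ⊆E⇒⊇V : (C D : Cycle G) → (∀ t → edge C t ∈E D) → ∀ p → vert D p ∈V C
  ⊆E⇒⊇V C D C⊆D = cyclic-induction (λ p → vert D p ∈V C) closure start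
    where
    start : vert D (proj₁ (C⊆D fzero)) ∈V C
    start = proj₁ (∈E⇒∈V C (fzero , sym (proj₂ (C⊆D fzero))) (joins D _))

    -- The two edges of C at a vertex of D are edges of D at that vertex, and they are
    -- distinct, so one of them leaves it along D.
    closure : ∀ p → vert D p ∈V C → vert D (next p) ∈V C
    closure p (u , vu≡vp) with next-surjective u
    ... | t , refl
      with edge-at-vertex D (C⊆D t) (subst (λ v → Joins G _ v _) vu≡vp (⊎-swap (joins C t)))
         | edge-at-vertex D (C⊆D (next t)) (subst (λ v → Joins G _ v _) vu≡vp (joins C (next t)))
    ... | inj₁ e | _      = t , sym e
    ... | inj₂ _ | inj₁ e = next (next t) , sym e
    ... | inj₂ a | inj₂ b = ⊥-elim (next-irreflexive t (sym (edge-injective C same-edge)))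
      where
      same-edge : edge C t ≡ edge C (next t)
      same-edge = trans (sym (proj₂ (C⊆D t)))
                        (trans (cong (edge D) (next-injective (trans a (sym b)))) (proj₂ (C⊆D (next t))))

module PathOfCycles {G : Graph} {m : ℕ} (𝒞 : Fin m → Cycle G) (cover : ∀ e → ∃ λ j → e ∈E 𝒞 j)
                    {n : ℕ} (path : IsPath (CI G 𝒞) n) where

  φ : Fin (suc n) ↔ Fin m
  φ = proj₁ path

  ψ : Fin n ↔ CIEdge G 𝒞
  ψ = proj₁ (proj₂ path)

  member : Fin (suc n) → Fin m
  member = Inverse.to φ

  position : Fin m → Fin (suc n)
  position = Inverse.from φ

  D : Fin (suc n) → Cycle G
  D i = 𝒞 (member i)

  pathEdge : CIEdge G 𝒞 → Fin n
  pathEdge = Inverse.from ψ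

  vertexOf : CIEdge G 𝒞 → Fin (V G)
  vertexOf (j , _ , _ , p , _) = vert (𝒞 j) p

  position-member : ∀ i → position (member i) ≡ i
  position-member = Inverse.strictlyInverseʳ φ

  member-injective : Injective _≡_ _≡_ member
  member-injective {i} {i'} e =
    trans (sym (position-member i)) (trans (cong position e) (position-member i'))

  pathEdge-injective : Injective _≡_ _≡_ pathEdge
  pathEdge-injective {e} {e'} s =
    trans (sym (Inverse.strictlyInverseˡ ψ e)) (trans (cong (Inverse.to ψ) s) (Inverse.strictlyInverseˡ ψ e'))

  pathEdge-spans : (e : CIEdge G 𝒞) →
                   PathEdge (pathEdge e) (position (proj₁ e)) (position (proj₁ (proj₂ e)))
  pathEdge-spans e
    with Inverse.to ψ (pathEdge e) | Inverse.strictlyInverseˡ ψ e | proj₂ (proj₂ path) (pathEdge e)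
  ... | _ | refl | ends = ⊎-map positions positions ends
    where
    positions : ∀ {j j' a b} → (j , j') ≡ (member a , member b) → (position j , position j') ≡ (a , b)
    positions refl = cong₂ _,_ (position-member _) (position-member _)

  ci-edge : ∀ {i i' x} → i ≢ i' → x ∈V D i → x ∈V D i' →
            Σ (CIEdge G 𝒞) λ e → PathEdge (pathEdge e) i i' × vertexOf e ≡ x
  ci-edge {i} {i'} i≢i' (p , hp) (p' , hp') with <-cmp (member i) (member i')
  ... | tri< lt _ _ = e , spans , hp
    where
    e : CIEdge G 𝒞
    e = member i , member i' , lt , p , p' , trans hp (sym hp')
    spans : PathEdge (pathEdge e) i i'
    spans = subst₂ (PathEdge (pathEdge e)) (position-member i) (position-member i') (pathEdge-spans e)
  ... | tri≈ _ eq _ = ⊥-elim (i≢i' (member-injective eq))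
  ... | tri> _ _ gt = e , PathEdge-sym spans , hp'
    where
    e : CIEdge G 𝒞
    e = member i' , member i , gt , p' , p , trans hp' (sym hp)
    spans : PathEdge (pathEdge e) i' i
    spans = subst₂ (PathEdge (pathEdge e)) (position-member i') (position-member i) (pathEdge-spans e)

  common⇒adjacent : ∀ {i i' x} → i ≢ i' → x ∈V D i → x ∈V D i' → Adjacent i i'
  common⇒adjacent i≢i' hx hx' = PathEdge⇒Adjacent (proj₁ (proj₂ (ci-edge i≢i' hx hx')))

  common-unique : ∀ {i i' x y} → i ≢ i' → x ∈V D i → x ∈V D i' → y ∈V D i → y ∈V D i' → x ≡ y
  common-unique i≢i' hx hx' hy hy' with ci-edge i≢i' hx hx' | ci-edge i≢i' hy hy'
  ... | e , se , refl | e' , se' , refl = cong vertexOf (pathEdge-injective (PathEdge-unique se se'))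

  consecutive-members-meet : (q : Fin n) → ∃ λ x → x ∈V D (inject₁ q) × x ∈V D (fsuc q)
  consecutive-members-meet q with Inverse.to ψ q | proj₂ (proj₂ path) q
  ... | j , _ , _ , p , p' , eq | inj₁ refl = vert (𝒞 j) p , (p , refl) , (p' , sym eq)
  ... | j , _ , _ , p , p' , eq | inj₂ refl = vert (𝒞 j) p , (p' , sym eq) , (p , refl)

  -- For the last member the successor condition is vacuous and any of its vertices will do.
  meets-successor : (i : Fin (suc n)) →
                    ∃ λ x → x ∈V D i × (∀ {i'} → toℕ i' ≡ suc (toℕ i) → x ∈V D i')
  meets-successor i with view i
  ... | ‵fromℕ     = vert (D (fromℕ n)) fzero , (fzero , refl) , λ {i'} e →
    ⊥-elim (<-irrefl (trans e (cong suc (toℕ-fromℕ n))) (toℕ<n i'))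
  ... | ‵inject₁ q = let (x , x∈Dq , x∈Dq+1) = consecutive-members-meet q in
    x , x∈Dq , λ e →
      subst (λ i' → x ∈V D i') (sym (toℕ-injective (trans e (cong suc (toℕ-inject₁ q))))) x∈Dq+1

  edge∈member : ∀ e → ∃ λ i → e ∈E D i
  edge∈member e = let (j , e∈𝒞j) = cover e in
    position j , subst (λ j' → e ∈E 𝒞 j') (sym (Inverse.strictlyInverseˡ φ j)) e∈𝒞j

  module Blocks (C : Cycle G) where

    block : Fin (suc (suc (k C))) → Fin (suc n)
    block t = proj₁ (edge∈member (edge C t))

    edge∈block : ∀ t → edge C t ∈E D (block t)
    edge∈block t = proj₂ (edge∈member (edge C t))

    shared : ∀ t → vert C (next t) ∈V D (block t) × vert C (next t) ∈V D (block (next t))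
    shared t = proj₂ (∈E⇒∈V (D (block t)) (edge∈block t) (joins C t))
             , proj₁ (∈E⇒∈V (D (block (next t))) (edge∈block (next t)) (joins C (next t)))

    top : Fin (suc n)
    top = block (argmax (toℕ ∘ block) fzero (allFin _))

    block≤top : ∀ t → toℕ (block t) ≤ toℕ top
    block≤top t = lookup (f[xs]≤f[argmax] {f = toℕ ∘ block} fzero (allFin _)) (∈-allFin t)

    below-top : ∀ {t x} → block t ≢ top → x ∈V D (block t) → x ∈V D top →
                toℕ top ≡ suc (toℕ (block t))
    below-top bt hx hx' = adjacent-below (common⇒adjacent (≢-sym bt) hx' hx) (block≤top _)

    -- Leaving the top member and re-entering it both go through the single vertex it
    -- shares with the member just below it, and C passes that vertex only once.
    no-return : ∀ {t s} → block t ≡ top → block (next t) ≢ top →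
                block s ≢ top → block (next s) ≡ top → ⊥
    no-return {t} {s} bt bnt bs bns = bs (subst (λ u → block u ≡ top) t≡s bt)
      where
      x∈top : vert C (next t) ∈V D top
      x∈top = subst (λ i → _ ∈V D i) bt (proj₁ (shared t))
      y∈top : vert C (next s) ∈V D top
      y∈top = subst (λ i → _ ∈V D i) bns (proj₂ (shared s))
      same-below : block (next t) ≡ block s
      same-below = toℕ-injective (suc-injective
        (trans (sym (below-top bnt (proj₂ (shared t)) x∈top)) (below-top bs (proj₁ (shared s)) y∈top)))
      x∈below : vert C (next t) ∈V D (block s)
      x∈below = subst (λ i → _ ∈V D i) same-below (proj₂ (shared t))
      t≡s : t ≡ s
      t≡s = next-injective (vert-injective C (common-unique bs x∈below x∈top (proj₁ (shared s)) y∈top))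

    block-constant : ∀ t → block t ≡ top
    block-constant t = decidable-stable (block t ≟ top) λ bt →
      let (_ , bt₁ , bnt₁) = cyclic-exit (λ u → block u ≡ top) (λ u → block u ≟ top) refl bt
          (s , bs , bns)   = cyclic-exit (λ u → block u ≢ top) (λ u → ¬? (block u ≟ top)) bt (λ ne → ne refl)
      in no-return bt₁ bnt₁ bs (decidable-stable (block (next s) ≟ top) bns)

    inside-top : ∀ t → edge C t ∈E D top
    inside-top t = subst (λ i → edge C t ∈E D i) (block-constant t) (edge∈block t)

  cycle-through-member : (C : Cycle G) → ∃ λ i → ∀ p → vert (D i) p ∈V C
  cycle-through-member C = top , ⊆E⇒⊇V C (D top) inside-top
    where open Blocks C

  decycling-size≥ : ∀ {S} → IsDecycling G S → ⌈ suc n /2⌉ ≤ ∣ S ∣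
  decycling-size≥ hits =
    injective⇒≤∣∣ chosen chosen-injective (λ r → proj₂ (hits (D (evenAt r))))
    where
    chosen : Fin ⌈ suc n /2⌉ → Fin (V G)
    chosen r = vert (D (evenAt r)) (proj₁ (hits (D (evenAt r))))
    chosen-injective : Injective _≡_ _≡_ chosen
    chosen-injective {r} {r'} e with evenAt r ≟ evenAt r'
    ... | yes same  = evenAt-injective same
    ... | no differ = ⊥-elim (evenAt-nonadjacent r r' (common⇒adjacent differ (_ , refl) (_ , sym e)))

  hub : Fin (suc n) → Fin (V G)
  hub i = proj₁ (meets-successor i)

  even-hubs : Subset (V G)
  even-hubs = image (hub ∘ evenAt)

  member-has-even-hub : ∀ i → ∃ λ r → hub (evenAt r) ∈V D i
  member-has-even-hub i with evenAt-covers i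
  ... | r , inj₁ e = r , subst (λ i' → hub (evenAt r) ∈V D i') (sym (toℕ-injective e))
                                (proj₁ (proj₂ (meets-successor (evenAt r))))
  ... | r , inj₂ e = r , proj₂ (proj₂ (meets-successor (evenAt r))) e

  even-hubs-decycling : IsDecycling G even-hubs
  even-hubs-decycling C =
    let (i , through)    = cycle-through-member C
        (r , p , vp≡hub) = member-has-even-hub i
        (t , vt≡vp)      = through p
    in t , subst (_∈ even-hubs) (sym (trans vt≡vp vp≡hub)) (∈image (hub ∘ evenAt) r)

  decycling-number : DecyclingNumberIs G ⌈ suc n /2⌉
  decycling-number =
    ( even-hubs
    , even-hubs-decycling
    , ≤-antisym (∣image∣≤ (hub ∘ evenAt)) (decycling-size≥ even-hubs-decycling))
    , λ _ → decycling-size≥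

theorem3 : (G : Graph) → Connected G → Even G →
           (m : ℕ) (𝒞 : Fin m → Cycle G) → IsCycleDecomposition G 𝒞 →
           (n : ℕ) → IsPath (CI G 𝒞) n →
           DecyclingNumberIs G ⌈ suc n /2⌉
theorem3 G _ _ m 𝒞 (cover , _) n path = PathOfCycles.decycling-number 𝒞 cover path
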